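{- Let $p$ be a prime number. Then the set $\mathcal{A}_p$ is empty.
   Context: For a positive integer $n$, $\Phi_n(x)$ denotes the $n$-th cyclotomic polynomial and $\mathcal{A}_n$ is the set of polynomials $f(x)\in\mathbb{Z}[x]$ such that $\Phi_n(x)$ divides $f(x)$ and $f(x)=x^m-a_{m-1}x^{m-1}-\cdots-a_1x-1$ for some integer $m<n$ with $a_i\in\{0,1\}$ for $1\le i<m$. -}

module Defs where

open import Data.Nat as ℕ using (ℕ; zero; suc; _∸_; _<ᵇ_)
open import Data.Nat.Divisibility using (_∣?_)
open import Data.Integer as ℤ using (ℤ; +_; -_)
open import Data.Bool using (Bool; true; false; if_then_else_)
open import Data.List using (List; []; _∷_; _++_; replicate; length; foldr; map; filter; upTo)
open import Data.Vec as Vec using (Vec)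
open import Relation.Binary.PropositionalEquality using (_≡_)
open import Relation.Nullary.Decidable using (does)
open import Data.Product using (Σ; ∃; _×_)

-- Polynomials in ℤ[x] as coefficient lists, lowest degree first.
-- Trailing zeros are allowed; equality is coefficientwise (_≈ₚ_).
Poly : Set
Poly = List ℤ

coeff : Poly → ℕ → ℤ
coeff []      _       = + 0
coeff (a ∷ p) zero    = a
coeff (a ∷ p) (suc k) = coeff p k

_≈ₚ_ : Poly → Poly → Set
p ≈ₚ q = ∀ k → coeff p k ≡ coeff q k

infixl 6 _+ₚ_ _-ₚ_
infixl 7 _*ₚ_

_+ₚ_ : Poly → Poly → Poly
[]      +ₚ q       = q
(a ∷ p) +ₚ []      = a ∷ p
(a ∷ p) +ₚ (b ∷ q) = (a ℤ.+ b) ∷ (p +ₚ q)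

negₚ : Poly → Poly
negₚ = map -_

_-ₚ_ : Poly → Poly → Poly
p -ₚ q = p +ₚ negₚ q

scaleₚ : ℤ → Poly → Poly
scaleₚ c = map (c ℤ.*_)

_*ₚ_ : Poly → Poly → Poly
[]      *ₚ q = []
(a ∷ p) *ₚ q = scaleₚ a q +ₚ (+ 0 ∷ (p *ₚ q))

_∣ₚ_ : Poly → Poly → Set
g ∣ₚ f = Σ Poly λ h → (g *ₚ h) ≈ₚ f

mono : ℤ → ℕ → Poly
mono c k = replicate k (+ 0) ++ (c ∷ [])

xⁿ-1 : ℕ → Poly
xⁿ-1 n = mono (+ 1) n -ₚ (+ 1 ∷ [])

norm : Poly → Poly
norm [] = []
norm (a ∷ p) with norm p
... | [] = if does (a ℤ.≟ + 0) then [] else a ∷ []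
... | q@(_ ∷ _) = a ∷ q

lastCoeff : Poly → ℤ
lastCoeff []          = + 0
lastCoeff (a ∷ [])    = a
lastCoeff (_ ∷ b ∷ p) = lastCoeff (b ∷ p)

-- quotient of long division by a monic polynomial, with fuel
quotFuel : ℕ → Poly → Poly → Poly
quotFuel zero     _ _ = []
quotFuel (suc fu) a b with norm a | norm b
... | a' | b' =
  if length a' ℕ.<ᵇ length b' then []
  else (let t = mono (lastCoeff a') (length a' ∸ length b')
        in t +ₚ quotFuel fu (a' -ₚ t *ₚ b') b')

quotₚ : Poly → Poly → Poly
quotₚ a b = quotFuel (suc (length a)) a b

prodₚ : List Poly → Poly
prodₚ = foldr _*ₚ_ (+ 1 ∷ [])

properDivisors : ℕ → List ℕ
properDivisors n = filter (λ d → d ∣? n) (upTo n)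

-- cyclotomic polynomials, via x^n - 1 = ∏_{d ∣ n} Φ_d, by recursion with fuel
cycFuel : ℕ → ℕ → Poly
cycFuel zero     n = []
cycFuel (suc fu) n = quotₚ (xⁿ-1 n) (prodₚ (map (cycFuel fu) (properDivisors n)))

Φ : ℕ → Poly
Φ n = cycFuel (suc n) n

-- f(x) = x^m - a_{m-1}x^{m-1} - ... - a_1 x - 1 with m = suc k,
-- a given as the vector (a_1, ..., a_{m-1}) of bits
bit : Bool → ℤ
bit true  = + 1
bit false = + 0

fPoly : (k : ℕ) → Vec Bool k → Poly
fPoly k a = (- + 1) ∷ (map (λ b → - bit b) (Vec.toList a) ++ (+ 1 ∷ []))

data 𝒜 (n : ℕ) : Poly → Set where
  mk𝒜 : (k : ℕ) → suc k ℕ.< n → (a : Vec Bool k) → Φ n ∣ₚ fPoly k a → 𝒜 n (fPoly k a)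

-- Evaluate at x = 2. For a prime p the only proper divisor of p is 1, so Φ p is the
-- quotient of x^p − 1 by x − 1 and Φ p (2) = 2^p − 1. On the other hand
-- f(2) = 2^m − 1 − Σ aᵢ 2^i = 1 + 2 Σ (1 − aᵢ) 2^(i−1) is a positive integer below
-- 2^m ≤ 2^(p−1) < 2^p − 1, so Φ p (2) cannot divide f(2), whereas Φ p ∣ f in ℤ[x]
-- would force it to.
module Submission where

open import Defs
open import Data.Bool.Base using (Bool; true; false; T; not)
open import Data.Empty using (⊥-elim)
open import Data.Nat.Base as ℕ using (ℕ; zero; suc; _≤_; _<_; _^_; _<ᵇ_; _∸_; s≤s; z≤n)
import Data.Nat.Properties as ℕ
open import Data.Nat.Divisibility using (_∣_; _∣?_; 1∣_; 0∣⇒≡0; ∣⇒≤; hasNonTrivialDivisor)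
open import Data.Nat.Primality using (Prime; prime; ¬prime[0]; ¬prime[1])
open import Data.Integer.Base as ℤ using (ℤ; +_; -_; ∣_∣)
import Data.Integer.Properties as ℤ
import Data.Integer.Divisibility as ℤ
open import Data.Integer.Tactic.RingSolver using (solve-∀)
open import Data.List.Base using (List; []; _∷_; _++_; length; replicate; map; applyUpTo; filter)
open import Data.List.Properties using (filter-accept; filter-reject; filter-none; length-map)
open import Data.List.Relation.Unary.All.Properties using (applyUpTo⁺₁)
open import Data.Vec.Base using (Vec; toList)
open import Data.Vec.Properties using (length-toList)
open import Data.Product.Base using (_,_)
open import Relation.Nullary.Negation using (¬_)
open import Relation.Nullary.Decidable using (dec-false)
open import Relation.Binary.PropositionalEquality
open ≡-Reasoning

eval : ℤ → Poly → ℤ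
eval x []      = + 0
eval x (a ∷ p) = a ℤ.+ x ℤ.* eval x p

eval-+ₚ : ∀ x p q → eval x (p +ₚ q) ≡ eval x p ℤ.+ eval x q
eval-+ₚ x []      q       = sym (ℤ.+-identityˡ (eval x q))
eval-+ₚ x (a ∷ p) []      = sym (ℤ.+-identityʳ (eval x (a ∷ p)))
eval-+ₚ x (a ∷ p) (b ∷ q) = begin
  a ℤ.+ b ℤ.+ x ℤ.* eval x (p +ₚ q)                ≡⟨ cong (λ e → a ℤ.+ b ℤ.+ x ℤ.* e) (eval-+ₚ x p q) ⟩
  a ℤ.+ b ℤ.+ x ℤ.* (eval x p ℤ.+ eval x q)        ≡⟨ horner-+ a b x (eval x p) (eval x q) ⟩
  a ℤ.+ x ℤ.* eval x p ℤ.+ (b ℤ.+ x ℤ.* eval x q)  ∎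
  where
  horner-+ : ∀ a b x u v → a ℤ.+ b ℤ.+ x ℤ.* (u ℤ.+ v) ≡ a ℤ.+ x ℤ.* u ℤ.+ (b ℤ.+ x ℤ.* v)
  horner-+ = solve-∀

eval-scaleₚ : ∀ x c p → eval x (scaleₚ c p) ≡ c ℤ.* eval x p
eval-scaleₚ x c []      = sym (ℤ.*-zeroʳ c)
eval-scaleₚ x c (a ∷ p) = begin
  c ℤ.* a ℤ.+ x ℤ.* eval x (scaleₚ c p)  ≡⟨ cong (λ e → c ℤ.* a ℤ.+ x ℤ.* e) (eval-scaleₚ x c p) ⟩
  c ℤ.* a ℤ.+ x ℤ.* (c ℤ.* eval x p)     ≡⟨ horner-scale c a x (eval x p) ⟩
  c ℤ.* (a ℤ.+ x ℤ.* eval x p)           ∎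
  where
  horner-scale : ∀ c a x u → c ℤ.* a ℤ.+ x ℤ.* (c ℤ.* u) ≡ c ℤ.* (a ℤ.+ x ℤ.* u)
  horner-scale = solve-∀

eval-*ₚ : ∀ x p q → eval x (p *ₚ q) ≡ eval x p ℤ.* eval x q
eval-*ₚ x []      q = refl
eval-*ₚ x (a ∷ p) q = begin
  eval x (scaleₚ a q +ₚ (+ 0 ∷ p *ₚ q))                        ≡⟨ eval-+ₚ x (scaleₚ a q) (+ 0 ∷ p *ₚ q) ⟩
  eval x (scaleₚ a q) ℤ.+ (+ 0 ℤ.+ x ℤ.* eval x (p *ₚ q))      ≡⟨ cong₂ (λ s e → s ℤ.+ (+ 0 ℤ.+ x ℤ.* e))
                                                                         (eval-scaleₚ x a q) (eval-*ₚ x p q) ⟩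
  a ℤ.* eval x q ℤ.+ (+ 0 ℤ.+ x ℤ.* (eval x p ℤ.* eval x q))  ≡⟨ horner-* a x (eval x p) (eval x q) ⟩
  (a ℤ.+ x ℤ.* eval x p) ℤ.* eval x q                          ∎
  where
  horner-* : ∀ a x u v → a ℤ.* v ℤ.+ (+ 0 ℤ.+ x ℤ.* (u ℤ.* v)) ≡ (a ℤ.+ x ℤ.* u) ℤ.* v
  horner-* = solve-∀

[]≈ₚ⇒eval≡0 : ∀ x q → [] ≈ₚ q → eval x q ≡ + 0
[]≈ₚ⇒eval≡0 x []      q≈0 = refl
[]≈ₚ⇒eval≡0 x (b ∷ q) q≈0 = begin
  b ℤ.+ x ℤ.* eval x q  ≡⟨ cong₂ (λ a e → a ℤ.+ x ℤ.* e) (sym (q≈0 0)) ([]≈ₚ⇒eval≡0 x q (λ k → q≈0 (suc k))) ⟩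
  + 0 ℤ.+ x ℤ.* + 0     ≡⟨ ℤ.+-identityˡ (x ℤ.* + 0) ⟩
  x ℤ.* + 0             ≡⟨ ℤ.*-zeroʳ x ⟩
  + 0                   ∎

eval-≈ₚ : ∀ x p q → p ≈ₚ q → eval x p ≡ eval x q
eval-≈ₚ x []      q       p≈q = sym ([]≈ₚ⇒eval≡0 x q p≈q)
eval-≈ₚ x (a ∷ p) []      p≈q = []≈ₚ⇒eval≡0 x (a ∷ p) (λ k → sym (p≈q k))
eval-≈ₚ x (a ∷ p) (b ∷ q) p≈q = cong₂ (λ a e → a ℤ.+ x ℤ.* e) (p≈q 0) (eval-≈ₚ x p q (λ k → p≈q (suc k)))

eval-∣ₚ : ∀ x {g f} → g ∣ₚ f → eval x g ℤ.∣ eval x f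
eval-∣ₚ x {g} {f} (h , gh≈f) = ℤ.divides ∣ eval x h ∣ (begin
  ∣ eval x f ∣                   ≡⟨ cong ∣_∣ (eval-≈ₚ x (g *ₚ h) f gh≈f) ⟨
  ∣ eval x (g *ₚ h) ∣            ≡⟨ cong ∣_∣ (eval-*ₚ x g h) ⟩
  ∣ eval x g ℤ.* eval x h ∣      ≡⟨ ℤ.abs-* (eval x g) (eval x h) ⟩
  ∣ eval x g ∣ ℕ.* ∣ eval x h ∣  ≡⟨ ℕ.*-comm ∣ eval x g ∣ ∣ eval x h ∣ ⟩
  ∣ eval x h ∣ ℕ.* ∣ eval x g ∣  ∎)

eval-mono : ∀ x c n → eval x (mono c n) ≡ c ℤ.* x ℤ.^ n
eval-mono x c zero    = horner-const c x
  where
  horner-const : ∀ c x → c ℤ.+ x ℤ.* + 0 ≡ c ℤ.* + 1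
  horner-const = solve-∀
eval-mono x c (suc n) = begin
  + 0 ℤ.+ x ℤ.* eval x (mono c n)  ≡⟨ cong (λ e → + 0 ℤ.+ x ℤ.* e) (eval-mono x c n) ⟩
  + 0 ℤ.+ x ℤ.* (c ℤ.* x ℤ.^ n)    ≡⟨ horner-mono x c (x ℤ.^ n) ⟩
  c ℤ.* (x ℤ.* x ℤ.^ n)            ∎
  where
  horner-mono : ∀ x c y → + 0 ℤ.+ x ℤ.* (c ℤ.* y) ≡ c ℤ.* (x ℤ.* y)
  horner-mono = solve-∀

+ₚ-identityʳ : ∀ p → p +ₚ [] ≡ p
+ₚ-identityʳ []      = refl
+ₚ-identityʳ (a ∷ p) = refl

length-mono : ∀ c n → length (mono c n) ≡ suc n
length-mono c zero    = refl
length-mono c (suc n) = cong suc (length-mono c n)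

lastCoeff-mono : ∀ c n → lastCoeff (mono c n) ≡ c
lastCoeff-mono c zero          = refl
lastCoeff-mono c (suc zero)    = refl
lastCoeff-mono c (suc (suc n)) = lastCoeff-mono c (suc n)

norm-∷ : ∀ a p {b q} → norm p ≡ b ∷ q → norm (a ∷ p) ≡ a ∷ b ∷ q
norm-∷ a p eq rewrite eq = refl

norm-∷-mono : ∀ a p c n → norm p ≡ mono c n → norm (a ∷ p) ≡ a ∷ mono c n
norm-∷-mono a p c zero    = norm-∷ a p
norm-∷-mono a p c (suc n) = norm-∷ a p

norm-mono : ∀ {c} n → c ≢ + 0 → norm (mono c n) ≡ mono c n
norm-mono {c} zero    c≢0 rewrite dec-false (c ℤ.≟ + 0) c≢0 = refl
norm-mono {c} (suc n) c≢0 = norm-∷-mono (+ 0) (mono c n) c n (norm-mono n c≢0)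

norm-++-0 : ∀ p → norm (p ++ + 0 ∷ []) ≡ norm p
norm-++-0 []      = refl
norm-++-0 (a ∷ p) rewrite norm-++-0 p = refl

<ᵇ-false : ∀ {m n} → n ≤ m → (m <ᵇ n) ≡ false
<ᵇ-false {m} {n} n≤m with m <ᵇ n in eq
... | false = refl
... | true  = ⊥-elim (ℕ.<⇒≱ (ℕ.<ᵇ⇒< m n (subst T (sym eq) _)) n≤m)

leadQuot : Poly → Poly → Poly
leadQuot a b = mono (lastCoeff a) (length a ∸ length b)

quotFuel-suc : ∀ fu a b {a' b'} → norm a ≡ a' → norm b ≡ b' → length b' ≤ length a' →
  quotFuel (suc fu) a b ≡ leadQuot a' b' +ₚ quotFuel fu (a' -ₚ leadQuot a' b' *ₚ b') b'
quotFuel-suc fu a b refl refl b≤a rewrite <ᵇ-false b≤a = refl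

x-1 : Poly
x-1 = - + 1 ∷ + 1 ∷ []

xⁿ-1-suc : ∀ n → xⁿ-1 (suc n) ≡ - + 1 ∷ mono (+ 1) n
xⁿ-1-suc n = cong (- + 1 ∷_) (+ₚ-identityʳ (mono (+ 1) n))

mono-*ₚ-x-1 : ∀ n → mono (+ 1) n *ₚ x-1 ≡ replicate n (+ 0) ++ x-1
mono-*ₚ-x-1 zero    = refl
mono-*ₚ-x-1 (suc n) = cong (+ 0 ∷_) (trans (cong ((+ 0 ∷ []) +ₚ_) (mono-*ₚ-x-1 n)) (zero-+ₚ n))
  where
  zero-+ₚ : ∀ n → (+ 0 ∷ []) +ₚ (replicate n (+ 0) ++ x-1) ≡ replicate n (+ 0) ++ x-1
  zero-+ₚ zero    = refl
  zero-+ₚ (suc n) = refl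

leadQuot-xⁿ⁺²-1 : ∀ n → leadQuot (- + 1 ∷ mono (+ 1) (suc n)) x-1 ≡ mono (+ 1) (suc n)
leadQuot-xⁿ⁺²-1 n = cong₂ mono (lastCoeff-mono (+ 1) (suc n)) (length-mono (+ 1) n)

norm-xⁿ⁺²-1-remainder : ∀ n →
  norm ((- + 1 ∷ mono (+ 1) (suc n)) -ₚ mono (+ 1) (suc n) *ₚ x-1) ≡ - + 1 ∷ mono (+ 1) n
norm-xⁿ⁺²-1-remainder n = begin
  norm ((- + 1 ∷ mono (+ 1) (suc n)) -ₚ mono (+ 1) (suc n) *ₚ x-1)
    ≡⟨ cong (λ q → norm ((- + 1 ∷ mono (+ 1) (suc n)) -ₚ q)) (mono-*ₚ-x-1 (suc n)) ⟩
  norm (- + 1 ∷ ((+ 0 ∷ mono (+ 1) n) -ₚ (replicate n (+ 0) ++ x-1)))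
    ≡⟨ cong (λ q → norm (- + 1 ∷ q)) (cancel n) ⟩
  norm (- + 1 ∷ (mono (+ 1) n ++ + 0 ∷ []))
    ≡⟨ norm-∷-mono (- + 1) (mono (+ 1) n ++ + 0 ∷ []) (+ 1) n
         (trans (norm-++-0 (mono (+ 1) n)) (norm-mono n λ ())) ⟩
  - + 1 ∷ mono (+ 1) n ∎
  where
  cancel : ∀ n → (+ 0 ∷ mono (+ 1) n) -ₚ (replicate n (+ 0) ++ x-1) ≡ mono (+ 1) n ++ + 0 ∷ []
  cancel zero    = refl
  cancel (suc n) = cong (+ 0 ∷_) (cancel n)

quotFuel-x-1-x-1 : ∀ fu a b → norm a ≡ x-1 → norm b ≡ x-1 → quotFuel (suc fu) a b ≡ + 1 ∷ []
quotFuel-x-1-x-1 zero     a b na nb rewrite na | nb = refl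
quotFuel-x-1-x-1 (suc fu) a b na nb rewrite na | nb = refl

geometric-step : ∀ x y e → e ℤ.* (x ℤ.- + 1) ≡ y ℤ.- + 1 →
  (+ 1 ℤ.* y ℤ.+ e) ℤ.* (x ℤ.- + 1) ≡ x ℤ.* y ℤ.- + 1
geometric-step x y e e[x-1]≡y-1 = begin
  (+ 1 ℤ.* y ℤ.+ e) ℤ.* (x ℤ.- + 1)        ≡⟨ distrib x y e ⟩
  y ℤ.* (x ℤ.- + 1) ℤ.+ e ℤ.* (x ℤ.- + 1)  ≡⟨ cong (λ t → y ℤ.* (x ℤ.- + 1) ℤ.+ t) e[x-1]≡y-1 ⟩
  y ℤ.* (x ℤ.- + 1) ℤ.+ (y ℤ.- + 1)        ≡⟨ collect x y ⟩
  x ℤ.* y ℤ.- + 1                          ∎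
  where
  distrib : ∀ x y e → (+ 1 ℤ.* y ℤ.+ e) ℤ.* (x ℤ.- + 1) ≡ y ℤ.* (x ℤ.- + 1) ℤ.+ e ℤ.* (x ℤ.- + 1)
  distrib = solve-∀
  collect : ∀ x y → y ℤ.* (x ℤ.- + 1) ℤ.+ (y ℤ.- + 1) ≡ x ℤ.* y ℤ.- + 1
  collect = solve-∀

-- The fuel bound n ≤ fu leaves one division step per power of x.
eval-quotFuel-x-1 : ∀ x fu n a b → n ≤ fu → norm a ≡ - + 1 ∷ mono (+ 1) n → norm b ≡ x-1 →
  eval x (quotFuel (suc fu) a b) ℤ.* (x ℤ.- + 1) ≡ x ℤ.^ suc n ℤ.- + 1
eval-quotFuel-x-1 x fu zero a b _ na nb =
  trans (cong (λ q → eval x q ℤ.* (x ℤ.- + 1)) (quotFuel-x-1-x-1 fu a b na nb)) (linear x)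
  where
  linear : ∀ x → (+ 1 ℤ.+ x ℤ.* + 0) ℤ.* (x ℤ.- + 1) ≡ x ℤ.* + 1 ℤ.- + 1
  linear = solve-∀
eval-quotFuel-x-1 x (suc fu) (suc n) a b (s≤s n≤fu) na nb = begin
  eval x (quotFuel (suc (suc fu)) a b) ℤ.* (x ℤ.- + 1)
    ≡⟨ cong (λ q → eval x q ℤ.* (x ℤ.- + 1)) (quotFuel-suc (suc fu) a b na nb (s≤s (s≤s z≤n))) ⟩
  eval x (leadQuot a' x-1 +ₚ quotFuel (suc fu) (a' -ₚ leadQuot a' x-1 *ₚ x-1) x-1) ℤ.* (x ℤ.- + 1)
    ≡⟨ cong (λ t → eval x (t +ₚ quotFuel (suc fu) (a' -ₚ t *ₚ x-1) x-1) ℤ.* (x ℤ.- + 1))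
            (leadQuot-xⁿ⁺²-1 n) ⟩
  eval x (mono (+ 1) (suc n) +ₚ q) ℤ.* (x ℤ.- + 1)
    ≡⟨ cong (ℤ._* (x ℤ.- + 1)) (eval-+ₚ x (mono (+ 1) (suc n)) q) ⟩
  (eval x (mono (+ 1) (suc n)) ℤ.+ eval x q) ℤ.* (x ℤ.- + 1)
    ≡⟨ cong (λ t → (t ℤ.+ eval x q) ℤ.* (x ℤ.- + 1)) (eval-mono x (+ 1) (suc n)) ⟩
  (+ 1 ℤ.* x ℤ.^ suc n ℤ.+ eval x q) ℤ.* (x ℤ.- + 1)
    ≡⟨ geometric-step x (x ℤ.^ suc n) (eval x q)
         (eval-quotFuel-x-1 x fu n r x-1 n≤fu (norm-xⁿ⁺²-1-remainder n) refl) ⟩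
  x ℤ.* x ℤ.^ suc n ℤ.- + 1 ∎
  where
  a' = - + 1 ∷ mono (+ 1) (suc n)
  r  = a' -ₚ mono (+ 1) (suc n) *ₚ x-1
  q  = quotFuel (suc fu) r x-1

properDivisors-prime : ∀ {p} → Prime p → properDivisors p ≡ 1 ∷ []
properDivisors-prime {0}           p-prime            = ⊥-elim (¬prime[0] p-prime)
properDivisors-prime {1}           p-prime            = ⊥-elim (¬prime[1] p-prime)
properDivisors-prime {suc (suc q)} (prime ¬composite) = begin
  filter (_∣? p) (0 ∷ 1 ∷ ds)  ≡⟨ filter-reject (_∣? p) {xs = 1 ∷ ds} (λ 0∣p → p≢0 (0∣⇒≡0 0∣p)) ⟩
  filter (_∣? p) (1 ∷ ds)      ≡⟨ filter-accept (_∣? p) {xs = ds} (1∣ p) ⟩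
  1 ∷ filter (_∣? p) ds        ≡⟨ cong (1 ∷_) (filter-none (_∣? p) (applyUpTo⁺₁ _ q ∤p)) ⟩
  1 ∷ []                       ∎
  where
  p  = suc (suc q)
  ds = applyUpTo (λ i → suc (suc i)) q
  p≢0 : p ≢ 0
  p≢0 ()
  ∤p : ∀ {i} → i < q → ¬ (suc (suc i) ∣ p)
  ∤p i<q d∣p = ¬composite (hasNonTrivialDivisor (s≤s (s≤s i<q)) d∣p)

eval-Φ-x-1 : ∀ x n → properDivisors (suc n) ≡ 1 ∷ [] →
  eval x (Φ (suc n)) ℤ.* (x ℤ.- + 1) ≡ x ℤ.^ suc n ℤ.- + 1
eval-Φ-x-1 x n divisors≡[1] =
  eval-quotFuel-x-1 x (length xⁿ⁺¹-1) n xⁿ⁺¹-1 divisorProduct n≤length norm-xⁿ⁺¹-1 norm-divisorProduct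
  where
  xⁿ⁺¹-1 = xⁿ-1 (suc n)
  divisorProduct = prodₚ (map (cycFuel (suc n)) (properDivisors (suc n)))
  n≤length : n ≤ length xⁿ⁺¹-1
  n≤length = subst (n ≤_) (sym (trans (cong length (xⁿ-1-suc n)) (cong suc (length-mono (+ 1) n))))
                   (ℕ.m≤n+m n 2)
  norm-xⁿ⁺¹-1 : norm xⁿ⁺¹-1 ≡ - + 1 ∷ mono (+ 1) n
  norm-xⁿ⁺¹-1 = trans (cong norm (xⁿ-1-suc n)) (norm-∷-mono (- + 1) (mono (+ 1) n) (+ 1) n (norm-mono n λ ()))
  norm-divisorProduct : norm divisorProduct ≡ x-1
  norm-divisorProduct = cong (λ ds → norm (prodₚ (map (cycFuel (suc n)) ds))) divisors≡[1]

pos-^ : ∀ m n → (+ m) ℤ.^ n ≡ + (m ^ n)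
pos-^ m zero    = refl
pos-^ m (suc n) = trans (cong (+ m ℤ.*_) (pos-^ m n)) (sym (ℤ.pos-* m (m ^ n)))

eval-2-Φ-prime : ∀ {p} → Prime p → eval (+ 2) (Φ p) ≡ + (2 ^ p ∸ 1)
eval-2-Φ-prime {0}     p-prime = ⊥-elim (¬prime[0] p-prime)
eval-2-Φ-prime {suc n} p-prime = begin
  eval (+ 2) (Φ (suc n))          ≡⟨ ℤ.*-identityʳ _ ⟨
  eval (+ 2) (Φ (suc n)) ℤ.* + 1  ≡⟨ eval-Φ-x-1 (+ 2) n (properDivisors-prime p-prime) ⟩
  (+ 2) ℤ.^ suc n ℤ.- + 1         ≡⟨ cong (ℤ._- + 1) (pos-^ 2 (suc n)) ⟩
  + (2 ^ suc n) ℤ.- + 1           ≡⟨ ℤ.⊖-≥ (ℕ.m^n>0 2 (suc n)) ⟩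
  + (2 ^ suc n ∸ 1)               ∎

-- Little-endian: the head of the list is the coefficient of 2^0.
fromBits : List Bool → ℕ
fromBits []           = 0
fromBits (false ∷ bs) = 2 ℕ.* fromBits bs
fromBits (true  ∷ bs) = suc (2 ℕ.* fromBits bs)

m<n⇒1+2m<2n : ∀ {m n} → m < n → suc (2 ℕ.* m) < 2 ℕ.* n
m<n⇒1+2m<2n {m} m<n = ℕ.≤-trans (ℕ.≤-reflexive (sym (ℕ.*-suc 2 m))) (ℕ.*-monoʳ-≤ 2 m<n)

fromBits-< : ∀ bs → fromBits bs < 2 ^ length bs
fromBits-< []           = s≤s z≤n
fromBits-< (false ∷ bs) = ℕ.<-trans (ℕ.n<1+n _) (m<n⇒1+2m<2n (fromBits-< bs))
fromBits-< (true  ∷ bs) = m<n⇒1+2m<2n (fromBits-< bs)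

eval-2-bits : ∀ bs → eval (+ 2) (map (λ b → - bit b) bs ++ + 1 ∷ []) ≡ + suc (fromBits (map not bs))
eval-2-bits []           = refl
eval-2-bits (false ∷ bs) =
  trans (cong (λ e → + 0 ℤ.+ + 2 ℤ.* e) (eval-2-bits bs)) (cong +_ (ℕ.*-suc 2 _))
eval-2-bits (true  ∷ bs) =
  trans (cong (λ e → - + 1 ℤ.+ + 2 ℤ.* e) (eval-2-bits bs)) (cong (λ n → - + 1 ℤ.+ + n) (ℕ.*-suc 2 _))

eval-2-fPoly : ∀ k a → eval (+ 2) (fPoly k a) ≡ + suc (2 ℕ.* fromBits (map not (toList a)))
eval-2-fPoly k a = eval-2-bits (true ∷ toList a)

eval-2-fPoly-< : ∀ k (a : Vec Bool k) → suc (2 ℕ.* fromBits (map not (toList a))) < 2 ^ suc k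
eval-2-fPoly-< k a = subst (λ n → suc (2 ℕ.* fromBits (map not (toList a))) < 2 ^ suc n)
  (trans (length-map not (toList a)) (length-toList a))
  (fromBits-< (true ∷ map not (toList a)))

lemma3p1 : (p : ℕ) → Prime p → (f : Poly) → ¬ 𝒜 p f
lemma3p1 p p-prime .(fPoly k a) (mk𝒜 k m<p a Φ∣f) = ℕ.<⇒≱ f[2]<Φ[2] Φ[2]≤f[2]
  where
  Φ[2]≤f[2] : 2 ^ p ∸ 1 ≤ suc (2 ℕ.* fromBits (map not (toList a)))
  Φ[2]≤f[2] = ∣⇒≤ (subst₂ ℤ._∣_ (eval-2-Φ-prime p-prime) (eval-2-fPoly k a)
                             (eval-∣ₚ (+ 2) {Φ p} {fPoly k a} Φ∣f))
  f[2]<Φ[2] : suc (2 ℕ.* fromBits (map not (toList a))) < 2 ^ p ∸ 1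
  f[2]<Φ[2] = ℕ.<-≤-trans (eval-2-fPoly-< k a) (ℕ.<⇒≤pred (ℕ.^-monoʳ-< 2 (s≤s (s≤s z≤n)) m<p))
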